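{- Let $\mathcal A$ be a countable structure. For every presentation $\hat{\mathcal A}$ of $\mathcal A$, $$P(\hat{\mathcal A})\le_e D(\hat{\mathcal A})=P(\hat{\mathcal A}^+)\le_e P(PJ(\hat{\mathcal A}))\le_e P(T(\hat{\mathcal A})).$$ In particular $Enum(\mathcal A)\le_{se}Enum(\mathcal A^+)\le_{se}Enum(PJ(\mathcal A))\le_{se}Enum(T(\mathcal A))$.
   Context: Structures have universe $\omega$ and countable relational language $(R_i)_i$; $P(\mathcal M)$ is the positive diagram (join of interpretations of $=$, $\neq$ and the relations of $\mathcal M$); $D(\mathcal M)$ is the atomic diagram; $\le_e$ enumeration reducibility. $\mathcal A^+=(A,(R_i^{\mathcal A},\overline{R_i^{\mathcal A}})_i)$. $\Sigma^p_1$ formulas: $\bigvee_{i\in I}\exists\bar y_i\varphi_i$, $I$ c.e., $\varphi_i$ finite conjunctions of atomic formulas (including $x=y$, $x\ne y$); $\Sigma^c_1$ formulas: same but with $\varphi_i$ finitary quantifier-free. With fixed computable enumerations $\varphi^{\Sigma^p_1}_{i,j}$, $\varphi^{\Sigma^c_1}_{i,j}$ (the $i$-th formula with free variables $x_1,\dots,x_j$), let $K^p_i=\bigcup_j\{\bar a\in A^j:\mathcal A\models\varphi^{\Sigma^p_1}_{i,j}(\bar a)\}$ and $K^c_i=\bigcup_j\{\bar a\in A^j:\mathcal A\models\varphi^{\Sigma^c_1}_{i,j}(\bar a)\}$. $PJ(\mathcal A)=(\mathcal A,(\overline{K^p_i})_i)$ and $T(\mathcal A)=(\mathcal A,(\overline{K^c_i})_i)$.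 For a surjection $f:\omega\to\omega$, $f^{ -1}(\mathcal M)$ is the structure on $\omega$ with relations $f^{ -1}(=),f^{ -1}(\neq),f^{ -1}(S)$ for $S$ a relation of $\mathcal M$ ($f^{ -1}(X)=\{\langle x_1,\dots\rangle:(f(x_1),\dots)\in X\}$); $Enum(\mathcal M)=\{P(f^{ -1}(\mathcal M)):f\text{ surjective}\}$. $\mathfrak A\le_{se}\mathfrak B$ if there is an enumeration operator $\Psi$ with $\Psi^B\in\mathfrak A$ for all $B\in\mathfrak B$. -}

module Defs where

open import Data.Nat using (ℕ; zero; suc; _+_; _*_)
open import Data.List using (List; []; _∷_; length; map; _++_)
open import Data.List.Relation.Unary.All using (All)
open import Data.Maybe using (Maybe; just; nothing)
open import Data.Product using (Σ; ∃; ∃-syntax; _×_; _,_)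
open import Data.Sum using (_⊎_)
open import Relation.Nullary using (¬_)
open import Relation.Binary.PropositionalEquality using (_≡_)
open import Function.Bundles using (_⇔_)

tri : ℕ → ℕ
tri zero    = zero
tri (suc n) = suc n + tri n

⟪_,_⟫ : ℕ → ℕ → ℕ
⟪ x , y ⟫ = tri (x + y) + x

-- code of a finite sequence (a bijection List ℕ → ℕ)
code : List ℕ → ℕ
code []      = zero
code (x ∷ l) = suc ⟪ x , code l ⟫

data Prog : Set where
  zer  : Prog
  succ : Prog
  proj : ℕ → Prog
  comp : Prog → List Prog → Prog
  prec : Prog → Prog → Prog

nth : List ℕ → ℕ → ℕ
nth []      _       = zero
nth (x ∷ _) zero    = x
nth (_ ∷ l) (suc i) = nth l i

mutual
  eval : Prog → List ℕ → ℕ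
  eval zer        xs       = zero
  eval succ       xs       = suc (nth xs zero)
  eval (proj i)   xs       = nth xs i
  eval (comp f gs) xs      = eval f (evalL gs xs)
  eval (prec f g) []       = eval f []
  eval (prec f g) (n ∷ xs) = evalRec f g n xs

  evalL : List Prog → List ℕ → List ℕ
  evalL []       xs = []
  evalL (g ∷ gs) xs = eval g xs ∷ evalL gs xs

  evalRec : Prog → Prog → ℕ → List ℕ → ℕ
  evalRec f g zero    xs = eval f xs
  evalRec f g (suc n) xs = eval g (evalRec f g n xs ∷ n ∷ xs)

mutual
  encProg : Prog → ℕ
  encProg zer         = ⟪ 0 , 0 ⟫
  encProg succ        = ⟪ 1 , 0 ⟫
  encProg (proj i)    = ⟪ 2 , i ⟫
  encProg (comp f gs) = ⟪ 3 , ⟪ encProg f , encProgs gs ⟫ ⟫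
  encProg (prec f g)  = ⟪ 4 , ⟪ encProg f , encProg g ⟫ ⟫

  encProgs : List Prog → ℕ
  encProgs []       = zero
  encProgs (g ∷ gs) = suc ⟪ encProg g , encProgs gs ⟫

-- the c.e. set W_p = { n : ∃ y. p(n,y) = 0 }   (Kleene normal form)
W : Prog → ℕ → Set
W p n = ∃[ y ] (eval p (n ∷ y ∷ []) ≡ zero)

Pred : Set₁
Pred = ℕ → Set

CE : Pred → Set
CE X = ∃[ p ] (∀ n → X n ⇔ W p n)

_≐_ : Pred → Pred → Set
X ≐ Y = ∀ n → X n ⇔ Y n

-- enumeration operator with c.e. index p (finite sets given as lists)
Ψ : Prog → Pred → Pred
Ψ p B x = ∃[ l ] (All B l × W p ⟪ x , code l ⟫)

_≤e_ : Pred → Pred → Set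
A ≤e B = ∃[ p ] (A ≐ Ψ p B)

_≤se_ : (Pred → Set) → (Pred → Set) → Set₁
𝔄 ≤se 𝔅 = ∃[ p ] (∀ B → 𝔅 B → 𝔄 (Ψ p B))

Sig : Set₁
Sig = ℕ → List ℕ → Set

record Language : Set where
  field
    arity     : ℕ → ℕ
    arityComp : ∃[ p ] (∀ i → eval p (i ∷ []) ≡ arity i)
open Language public

record Structure (L : Language) : Set₁ where
  field
    Rel     : Sig
    arityOK : ∀ i l → Rel i l → length l ≡ arity L i
open Structure public

-- join of interpretations of E (equality), N (inequality) and relations R
PG : (ℕ → ℕ → Set) → (ℕ → ℕ → Set) → Sig → Pred
PG E N R n =
  (∃[ x ] ∃[ y ] (n ≡ ⟪ 0 , code (x ∷ y ∷ []) ⟫ × E x y))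
  ⊎ (∃[ x ] ∃[ y ] (n ≡ ⟪ 1 , code (x ∷ y ∷ []) ⟫ × N x y))
  ⊎ (∃[ i ] ∃[ l ] (n ≡ ⟪ suc (suc i) , code l ⟫ × R i l))

_≢_ : ℕ → ℕ → Set
x ≢ y = ¬ (x ≡ y)

Pos : Sig → Pred
Pos R = PG _≡_ _≢_ R

P : ∀ {L} → Structure L → Pred
P 𝓜 = Pos (Rel 𝓜)

D : ∀ {L} → Structure L → Pred
D {L} 𝓜 n =
  (∃[ x ] ∃[ y ] (n ≡ ⟪ 0 , code (x ∷ y ∷ []) ⟫ × x ≡ y))
  ⊎ (∃[ x ] ∃[ y ] (n ≡ ⟪ 1 , code (x ∷ y ∷ []) ⟫ × x ≢ y))
  ⊎ (∃[ i ] ∃[ l ] (n ≡ ⟪ 2 + 2 * i , code l ⟫ × Rel 𝓜 i l))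
  ⊎ (∃[ i ] ∃[ l ] (n ≡ ⟪ 3 + 2 * i , code l ⟫
                     × (length l ≡ arity L i × ¬ Rel 𝓜 i l)))

interleave : {X : Set₁} → (ℕ → X) → (ℕ → X) → ℕ → X
interleave f g zero          = f zero
interleave f g (suc zero)    = g zero
interleave f g (suc (suc n)) = interleave (λ i → f (suc i)) (λ i → g (suc i)) n

Plus : ∀ {L} → Structure L → Sig
Plus {L} 𝓜 = interleave (Rel 𝓜) (λ i l → length l ≡ arity L i × ¬ Rel 𝓜 i l)

-- Variables are numbers: for a formula with free variables
-- x_1..x_j and bound variables y_1..y_k, index v < j refers to x_{v+1}
-- and index j+m refers to y_{m+1}; atoms with out-of-range variables
-- (or a relation applied to the wrong number of arguments) are false.

data Atom : Set where
  eqA  : ℕ → ℕ → Atom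
  neqA : ℕ → ℕ → Atom
  relA : ℕ → List ℕ → Atom

data QF : Set where
  atom : Atom → QF
  top  : QF
  neg  : QF → QF
  and  : QF → QF → QF
  or   : QF → QF → QF

encAtom : Atom → ℕ
encAtom (eqA u v)   = ⟪ 0 , ⟪ u , v ⟫ ⟫
encAtom (neqA u v)  = ⟪ 1 , ⟪ u , v ⟫ ⟫
encAtom (relA r vs) = ⟪ 2 , ⟪ r , code vs ⟫ ⟫

encQF : QF → ℕ
encQF (atom a)  = ⟪ 0 , encAtom a ⟫
encQF top       = ⟪ 1 , 0 ⟫
encQF (neg φ)   = ⟪ 2 , encQF φ ⟫
encQF (and φ ψ) = ⟪ 3 , ⟪ encQF φ , encQF ψ ⟫ ⟫
encQF (or φ ψ)  = ⟪ 4 , ⟪ encQF φ , encQF ψ ⟫ ⟫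

-- a Σ^p_1 disjunct  ∃ y_1..y_k (a_1 ∧ ... ∧ a_m)
record DisjP : Set where
  constructor dP
  field
    nBound : ℕ
    atoms  : List Atom

-- a Σ^c_1 disjunct  ∃ y_1..y_k φ  with φ finitary quantifier-free
record DisjC : Set where
  constructor dC
  field
    nBound : ℕ
    matrix : QF

encDisjP : DisjP → ℕ
encDisjP (dP k as) = ⟪ k , code (map encAtom as) ⟫

encDisjC : DisjC → ℕ
encDisjC (dC k φ) = ⟪ k , encQF φ ⟫

lookupM : List ℕ → ℕ → Maybe ℕ
lookupM []      _       = nothing
lookupM (x ∷ _) zero    = just x
lookupM (_ ∷ l) (suc i) = lookupM l i

lookupsM : List ℕ → List ℕ → Maybe (List ℕ)
lookupsM env []       = just []
lookupsM env (v ∷ vs) with lookupM env v | lookupsM env vs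
... | just a  | just as = just (a ∷ as)
... | _       | _       = nothing

satAtom : Sig → List ℕ → Atom → Set
satAtom R env (eqA u v)   = ∃[ a ] ∃[ b ] (lookupM env u ≡ just a × lookupM env v ≡ just b × a ≡ b)
satAtom R env (neqA u v)  = ∃[ a ] ∃[ b ] (lookupM env u ≡ just a × lookupM env v ≡ just b × a ≢ b)
satAtom R env (relA r vs) = ∃[ as ] (lookupsM env vs ≡ just as × R r as)

satQF : Sig → List ℕ → QF → Set
satQF R env (atom a)  = satAtom R env a
satQF R env top       = Data.Unit.⊤
  where import Data.Unit
satQF R env (neg φ)   = ¬ satQF R env φ
satQF R env (and φ ψ) = satQF R env φ × satQF R env ψ
satQF R env (or φ ψ)  = satQF R env φ ⊎ satQF R env ψ

Tuple : ℕ → Set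
Tuple k = Σ (List ℕ) (λ b → length b ≡ k)

satDisjP : Sig → List ℕ → DisjP → Set
satDisjP R as (dP k ats) = Σ (Tuple k) (λ b → All (satAtom R (as ++ Σ.proj₁ b)) ats)

satDisjC : Sig → List ℕ → DisjC → Set
satDisjC R as (dC k φ) = Σ (Tuple k) (λ b → satQF R (as ++ Σ.proj₁ b) φ)

-- The i-th Σ^p_1 (resp. Σ^c_1) formula: if i is the code of a program p,
-- it is the disjunction of all disjuncts whose code lies in W_p; if i is
-- not a program code, it is the empty disjunction.  Evaluated at a tuple
-- a of length j, it is the i-th formula with free variables x_1..x_j.
Kp : Sig → Sig
Kp R i as = ∃[ p ] (encProg p ≡ i × ∃[ d ] (W p (encDisjP d) × satDisjP R as d))

Kc : Sig → Sig
Kc R i as = ∃[ p ] (encProg p ≡ i × ∃[ d ] (W p (encDisjC d) × satDisjC R as d))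

PJ : ∀ {L} → Structure L → Sig
PJ 𝓐 = interleave (Rel 𝓐) (λ i as → ¬ Kp (Rel 𝓐) i as)

TJ : ∀ {L} → Structure L → Sig
TJ 𝓐 = interleave (Rel 𝓐) (λ i as → ¬ Kc (Rel 𝓐) i as)

Surjective : (ℕ → ℕ) → Set
Surjective f = ∀ y → ∃[ x ] (f x ≡ y)

Pinv : (ℕ → ℕ) → Sig → Pred
Pinv f R = PG (λ x y → f x ≡ f y) (λ x y → f x ≢ f y) (λ i l → R i (map f l))

Enum : Sig → Pred → Set
Enum R X = ∃[ f ] (Surjective f × X ≐ Pinv f R)

module Submission where

-- Each of the three reductions is witnessed by a relabelling, an enumeration operator that
-- enumerates ⟪ t , c ⟫ as soon as ⟪ t' , c ⟫ is enumerated in its input, for t' chosen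
-- computably from t (and the length of the tuple coded by c); the tags 0 and 1 of = and ≠
-- are copied. A relabelling never looks at the elements of the tuples, so it also sends
-- P(f⁻¹(𝓝)) to P(f⁻¹(𝓜)) for every surjection f, which gives the ≤se statements.
-- For 𝓐 ≤ 𝓐⁺, R_i is R_{2i} of 𝓐⁺. For 𝓐⁺ ≤ PJ(𝓐), the complement of R_k on tuples of the
-- right length is the complement of K^p_{a(k)}, where a(k) indexes the Σ^p_1 formula
-- R_k(x_1, …, x_n). For PJ(𝓐) ≤ T(𝓐), the complement of K^p_i is the complement of
-- K^c_{b(i)}, where the b(i)-th Σ^c_1 formula has the disjuncts of the i-th Σ^p_1 formula
-- with their atoms conjoined; b is computable since it only composes the enumeration of
-- disjunct codes with a primitive recursive translation of codes. D(𝓐) and P(𝓐⁺) differ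
-- only in how the tags of the relations are numbered.

open import Defs

open import Data.Nat using (ℕ; zero; suc; _+_; _*_; _∸_; ∣_-_∣; _≤_; _<_; z≤n; s≤s; pred)
open import Data.Nat.Properties
open import Data.List using (List; []; _∷_; length; map; _++_; foldl)
open import Data.List.Properties using (length-map; ++-identityʳ; map-injective)
open import Data.List.Relation.Unary.All using (All; []; _∷_)
open import Data.List.Relation.Unary.Any using (Any; here; there)
open import Data.Maybe as Maybe using (just; nothing)
open import Data.Maybe.Properties using (just-injective)
open import Data.Product using (_×_; ∃-syntax; _,_; proj₁; proj₂)
open import Data.Sum using (_⊎_; inj₁; inj₂)
open import Data.Empty using (⊥-elim)
open import Data.Unit using (tt)
open import Relation.Nullary using (¬_)
open import Relation.Binary.PropositionalEquality
  using (_≡_; refl; sym; trans; cong; cong₂; subst; subst₂; module ≡-Reasoning)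
open import Function.Bundles using (_⇔_; mk⇔; Equivalence)
open import Relation.Nullary.Decidable.Core using (recompute)

open Equivalence using (to; from)

tri-mono-≤ : ∀ {m n} → m ≤ n → tri m ≤ tri n
tri-mono-≤ {zero}  _       = z≤n
tri-mono-≤ {suc m} (s≤s p) = s≤s (+-mono-≤ p (tri-mono-≤ p))

n≤tri : ∀ n → n ≤ tri n
n≤tri zero    = z≤n
n≤tri (suc n) = s≤s (m≤m+n n (tri n))

-- The diagonal x + y of ⟪ x , y ⟫ is the number of k with tri (suc k) ≤ ⟪ x , y ⟫,
-- a bounded count and hence primitive recursive; 1 ∸ (a ∸ n) is the indicator of a ≤ n.
reached : ℕ → ℕ → ℕ
reached n k = 1 ∸ (tri (suc k) ∸ n)

countReached : ℕ → ℕ → ℕ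
countReached n zero    = zero
countReached n (suc m) = countReached n m + reached n m

reached-≤ : ∀ {n} k → tri (suc k) ≤ n → reached n k ≡ 1
reached-≤ k p rewrite m≤n⇒m∸n≡0 p = refl

reached-> : ∀ {n} k → n < tri (suc k) → reached n k ≡ 0
reached-> {n} k p with tri (suc k) ∸ n | m<n⇒0<n∸m p
... | suc d | _ = 0∸n≡0 d

countReached-below : ∀ n S → (∀ k → k < S → reached n k ≡ 1) → ∀ m → m ≤ S → countReached n m ≡ m
countReached-below n S h zero    _ = refl
countReached-below n S h (suc m) p
  rewrite countReached-below n S h m (<⇒≤ p) | h m p = +-comm m 1

countReached-above : ∀ n S → (∀ k → k < S → reached n k ≡ 1) → (∀ k → S ≤ k → reached n k ≡ 0) →
                     ∀ d → countReached n (S + d) ≡ S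
countReached-above n S below above zero
  rewrite +-identityʳ S = countReached-below n S below S ≤-refl
countReached-above n S below above (suc d)
  rewrite +-suc S d | countReached-above n S below above d | above (S + d) (m≤m+n S d) = +-identityʳ S

diagonal : ℕ → ℕ
diagonal n = countReached n n

diagonal-pair : ∀ x y → diagonal ⟪ x , y ⟫ ≡ x + y
diagonal-pair x y =
  trans (cong (countReached n) (sym (m+[n∸m]≡n S≤n))) (countReached-above n S below above (n ∸ S))
  where
  S n : ℕ
  S = x + y
  n = ⟪ x , y ⟫
  S≤n : S ≤ n
  S≤n = ≤-trans (n≤tri S) (m≤m+n (tri S) x)
  below : ∀ k → k < S → reached n k ≡ 1
  below k p = reached-≤ k (≤-trans (tri-mono-≤ p) (m≤m+n (tri S) x))
  above : ∀ k → S ≤ k → reached n k ≡ 0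
  above k p = reached-> k (begin-strict
    tri S + x        <⟨ +-monoʳ-< (tri S) (s≤s (m≤m+n x y)) ⟩
    tri S + suc S    ≡⟨ +-comm (tri S) (suc S) ⟩
    tri (suc S)      ≤⟨ tri-mono-≤ (s≤s p) ⟩
    tri (suc k)      ∎)
    where open ≤-Reasoning

opaque
  unpair₁ : ℕ → ℕ
  unpair₁ n = n ∸ tri (diagonal n)

  unpair₂ : ℕ → ℕ
  unpair₂ n = diagonal n ∸ unpair₁ n

  unpair₁-def : ∀ n → unpair₁ n ≡ n ∸ tri (diagonal n)
  unpair₁-def n = refl

  unpair₂-def : ∀ n → unpair₂ n ≡ diagonal n ∸ unpair₁ n
  unpair₂-def n = refl

  unpair₁-pair : ∀ x y → unpair₁ ⟪ x , y ⟫ ≡ x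
  unpair₁-pair x y rewrite diagonal-pair x y = m+n∸m≡n (tri (x + y)) x

  unpair₂-pair : ∀ x y → unpair₂ ⟪ x , y ⟫ ≡ y
  unpair₂-pair x y rewrite unpair₁-pair x y | diagonal-pair x y = m+n∸m≡n x y

pair-injective : ∀ a b c d → ⟪ a , b ⟫ ≡ ⟪ c , d ⟫ → a ≡ c × b ≡ d
pair-injective a b c d e =
  trans (sym (unpair₁-pair a b)) (trans (cong unpair₁ e) (unpair₁-pair c d)) ,
  trans (sym (unpair₂-pair a b)) (trans (cong unpair₂ e) (unpair₂-pair c d))

pair-surjective : ∀ n → ∃[ x ] ∃[ y ] (⟪ x , y ⟫ ≡ n)
pair-surjective zero = 0 , 0 , refl
pair-surjective (suc n) with pair-surjective n
... | x , zero , refl =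
  0 , suc x , cong suc (trans (+-identityʳ (x + tri x)) (trans (+-comm x (tri x))
                 (cong (λ z → tri z + x) (sym (+-identityʳ x)))))
... | x , suc y , refl =
  suc x , y , trans (cong (λ z → tri z + suc x) (sym (+-suc x y))) (+-suc (tri (x + suc y)) x)

code-injective : ∀ {l l'} → code l ≡ code l' → l ≡ l'
code-injective {[]}    {[]}     e = refl
code-injective {x ∷ l} {y ∷ l'} e with pair-injective x (code l) y (code l') (suc-injective e)
... | refl , e' = cong (x ∷_) (code-injective e')

≤-pair : ∀ x c → c ≤ ⟪ x , c ⟫
≤-pair x c = ≤-trans (m≤n+m c x) (≤-trans (n≤tri (x + c)) (m≤m+n _ x))

length≤code : ∀ l → length l ≤ code l
length≤code []      = z≤n
length≤code (x ∷ l) = s≤s (≤-trans (length≤code l) (≤-pair x (code l)))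

code-surjective : ∀ n → ∃[ l ] (code l ≡ n)
code-surjective n = bounded n n ≤-refl
  where
  bounded : ∀ fuel n → n ≤ fuel → ∃[ l ] (code l ≡ n)
  bounded _          zero    _       = [] , refl
  bounded (suc fuel) (suc n) (s≤s p) with pair-surjective n
  ... | x , c , refl with bounded fuel c (≤-trans (≤-pair x c) p)
  ... | l , refl = x ∷ l , refl

-- The correctness proof is irrelevant so that it is never unfolded during type checking.
record PRF : Set where
  constructor prf
  field
    fun  : List ℕ → ℕ
    prog : Prog
    .ok  : ∀ xs → eval prog xs ≡ fun xs
open PRF

prog-ok : (F : PRF) → ∀ xs → eval (prog F) xs ≡ fun F xs
prog-ok (prf f p o) xs = recompute (eval p xs ≟ f xs) (o xs)

funs : List PRF → List ℕ → List ℕ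
funs []       xs = []
funs (G ∷ Gs) xs = fun G xs ∷ funs Gs xs

progs : List PRF → List Prog
progs []       = []
progs (G ∷ Gs) = prog G ∷ progs Gs

evalL-progs : ∀ Gs xs → evalL (progs Gs) xs ≡ funs Gs xs
evalL-progs []       xs = refl
evalL-progs (G ∷ Gs) xs = cong₂ _∷_ (prog-ok G xs) (evalL-progs Gs xs)

zeroF succF : PRF
zeroF = prf (λ _ → 0) zer (λ _ → refl)
succF = prf (λ xs → suc (nth xs 0)) succ (λ _ → refl)

arg : ℕ → PRF
arg i = prf (λ xs → nth xs i) (proj i) (λ _ → refl)

compF : PRF → List PRF → PRF
compF F Gs = prf (λ xs → fun F (funs Gs xs)) (comp (prog F) (progs Gs))
  (λ xs → trans (prog-ok F (evalL (progs Gs) xs)) (cong (fun F) (evalL-progs Gs xs)))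

app₁ : PRF → PRF → PRF
app₁ F a = compF F (a ∷ [])

app₂ : PRF → PRF → PRF → PRF
app₂ F a b = compF F (a ∷ b ∷ [])

app₃ : PRF → PRF → PRF → PRF → PRF
app₃ F a b c = compF F (a ∷ b ∷ c ∷ [])

at : PRF → ℕ → ℕ
at F k = fun F (k ∷ [])

extF : (F : PRF) (f : List ℕ → ℕ) → (∀ xs → fun F xs ≡ f xs) → PRF
extF F f e = prf f (prog F) (λ xs → trans (prog-ok F xs) (e xs))

progF : Prog → PRF
progF p = prf (eval p) p (λ _ → refl)

recursionF : (F G : PRF) (f : List ℕ → ℕ) → fun F [] ≡ f [] → (∀ xs → fun F xs ≡ f (0 ∷ xs)) →
             (∀ n xs → fun G (f (n ∷ xs) ∷ n ∷ xs) ≡ f (suc n ∷ xs)) → PRF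
recursionF F G f empty base step = prf f (prec (prog F) (prog G)) correct
  where
  evalRec-ok : ∀ n xs → evalRec (prog F) (prog G) n xs ≡ f (n ∷ xs)
  evalRec-ok zero    xs = trans (prog-ok F xs) (base xs)
  evalRec-ok (suc n) xs =
    trans (prog-ok G _) (trans (cong (λ r → fun G (r ∷ n ∷ xs)) (evalRec-ok n xs)) (step n xs))
  correct : ∀ xs → eval (prec (prog F) (prog G)) xs ≡ f xs
  correct []       = trans (prog-ok F []) empty
  correct (n ∷ xs) = evalRec-ok n xs

predF addF monusF mulF triF : PRF
predF = recursionF zeroF (arg 1) (λ xs → pred (nth xs 0)) refl (λ _ → refl) (λ _ _ → refl)
addF = recursionF (arg 0) (app₁ succF (arg 0)) (λ xs → nth xs 0 + nth xs 1)
  refl (λ _ → refl) (λ _ _ → refl)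
monusF = app₂ flipped (arg 1) (arg 0)
  where
  flipped : PRF
  flipped = recursionF (arg 0) (app₁ predF (arg 0)) (λ xs → nth xs 1 ∸ nth xs 0)
    refl (λ _ → refl) (λ n xs → pred[m∸n]≡m∸[1+n] (nth xs 0) n)
mulF = recursionF zeroF (app₂ addF (arg 0) (arg 2)) (λ xs → nth xs 0 * nth xs 1)
  refl (λ _ → refl) (λ n xs → +-comm (n * nth xs 0) (nth xs 0))
triF = recursionF zeroF (app₂ addF (app₁ succF (arg 1)) (arg 0)) (λ xs → tri (nth xs 0))
  refl (λ _ → refl) (λ _ _ → refl)

numeral : ℕ → Prog
numeral zero    = zer
numeral (suc k) = comp succ (numeral k ∷ [])

eval-numeral : ∀ k xs → eval (numeral k) xs ≡ k
eval-numeral zero    xs = refl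
eval-numeral (suc k) xs = cong suc (eval-numeral k xs)

constF : ℕ → PRF
constF n = prf (λ _ → n) (numeral n) (eval-numeral n)

pairF : PRF
pairF = extF (app₂ addF (app₁ triF (app₂ addF (arg 0) (arg 1))) (arg 0))
  (λ xs → ⟪ nth xs 0 , nth xs 1 ⟫) (λ _ → refl)

diagonalF : PRF
diagonalF = extF (app₂ countF (arg 0) (arg 0)) (λ xs → diagonal (nth xs 0)) (λ _ → refl)
  where
  reachedF countF : PRF
  reachedF = extF (app₂ monusF (constF 1) (app₂ monusF (app₁ triF (app₁ succF (arg 1))) (arg 0)))
    (λ xs → reached (nth xs 0) (nth xs 1)) (λ _ → refl)
  countF = recursionF zeroF (app₂ addF (arg 0) (app₂ reachedF (arg 2) (arg 1)))
    (λ xs → countReached (nth xs 1) (nth xs 0)) refl (λ _ → refl) (λ _ _ → refl)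

unpair₁F unpair₂F : PRF
unpair₁F = extF (app₂ monusF (arg 0) (app₁ triF diagonalF)) (λ xs → unpair₁ (nth xs 0))
  (λ xs → sym (unpair₁-def (nth xs 0)))
unpair₂F = extF (app₂ monusF diagonalF unpair₁F) (λ xs → unpair₂ (nth xs 0))
  (λ xs → sym (unpair₂-def (nth xs 0)))

monus-dist : ∀ a b → (a ∸ b) + (b ∸ a) ≡ ∣ a - b ∣
monus-dist zero    zero    = refl
monus-dist zero    (suc b) = refl
monus-dist (suc a) zero    = +-identityʳ (suc a)
monus-dist (suc a) (suc b) = monus-dist a b

distF : PRF
distF = extF (app₂ addF (app₂ monusF (arg 0) (arg 1)) (app₂ monusF (arg 1) (arg 0)))
  (λ xs → ∣ nth xs 0 - nth xs 1 ∣) (λ xs → monus-dist (nth xs 0) (nth xs 1))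

ifz : ℕ → ℕ → ℕ → ℕ
ifz zero    a b = a
ifz (suc _) a b = b

ifzF : PRF
ifzF = recursionF (arg 0) (arg 3) (λ xs → ifz (nth xs 0) (nth xs 1) (nth xs 2))
  refl (λ _ → refl) (λ _ _ → refl)

headCode tailCode : ℕ → ℕ
headCode z = unpair₁ (pred z)
tailCode z = unpair₂ (pred z)

tailCode-code : ∀ x l → tailCode (code (x ∷ l)) ≡ code l
tailCode-code x l = unpair₂-pair x (code l)

-- The fold runs for code l ≥ length l steps, each step consuming the head of the
-- remaining code and doing nothing once the remaining code is 0 = code [].
module FoldCode (h : PRF) (a₀ : ℕ) where

  step : ℕ → ℕ → ℕ
  step a x = fun h (a ∷ x ∷ [])

  remaining : ℕ → ℕ → ℕ
  remaining c zero    = c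
  remaining c (suc t) = tailCode (remaining c t)

  accumulated : ℕ → ℕ → ℕ
  accumulated c zero    = a₀
  accumulated c (suc t) =
    ifz (remaining c t) (accumulated c t) (step (accumulated c t) (headCode (remaining c t)))

  remainingF accumulatedF : PRF
  remainingF = recursionF (arg 0) (app₁ unpair₂F (app₁ predF (arg 0)))
    (λ xs → remaining (nth xs 1) (nth xs 0)) refl (λ _ → refl) (λ _ _ → refl)
  accumulatedF = recursionF (constF a₀)
    (app₃ ifzF (app₂ remainingF (arg 1) (arg 2)) (arg 0)
      (app₂ h (arg 0) (app₁ unpair₁F (app₁ predF (app₂ remainingF (arg 1) (arg 2))))))
    (λ xs → accumulated (nth xs 1) (nth xs 0)) refl (λ _ → refl) (λ _ _ → refl)

  foldCode : ℕ → ℕ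
  foldCode c = accumulated c c

  foldCodeF : PRF
  foldCodeF = extF (app₂ accumulatedF (arg 0) (arg 0)) (λ xs → foldCode (nth xs 0)) (λ _ → refl)

  State : Set
  State = ℕ × ℕ

  stepState : State → State
  stepState (a , z) = ifz z a (step a (headCode z)) , tailCode z

  run : ℕ → State → State
  run zero    s = s
  run (suc t) s = stepState (run t s)

  run-suc : ∀ t s → run (suc t) s ≡ run t (stepState s)
  run-suc zero    s = refl
  run-suc (suc t) s = cong stepState (run-suc t s)

  run-components : ∀ c t → run t (a₀ , c) ≡ (accumulated c t , remaining c t)
  run-components c zero = refl
  run-components c (suc t) rewrite run-components c t = refl

  run-done : ∀ t a → run t (a , 0) ≡ (a , 0)
  run-done zero    a = refl
  run-done (suc t) a = trans (cong stepState (run-done t a)) (cong (a ,_) (unpair₂-pair 0 0))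

  run-code : ∀ l t a → length l ≤ t → run t (a , code l) ≡ (foldl step a l , 0)
  run-code []      t       a _       = run-done t a
  run-code (x ∷ l) (suc t) a (s≤s p) = begin
    run (suc t) (a , code (x ∷ l))    ≡⟨ run-suc t _ ⟩
    run t (stepState (a , code (x ∷ l)))
      ≡⟨ cong (run t) (cong₂ _,_ (cong (step a) (unpair₁-pair x (code l))) (tailCode-code x l)) ⟩
    run t (step a x , code l)         ≡⟨ run-code l t (step a x) p ⟩
    (foldl step (step a x) l , 0)     ∎
    where open ≡-Reasoning

  foldCode-code : ∀ l → foldCode (code l) ≡ foldl step a₀ l
  foldCode-code l =
    cong proj₁ (trans (sym (run-components (code l) (code l))) (run-code l (code l) a₀ (length≤code l)))

lengthCode : ℕ → ℕ
lengthCode = FoldCode.foldCode (app₁ succF (arg 0)) 0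

lengthCodeF : PRF
lengthCodeF = FoldCode.foldCodeF (app₁ succF (arg 0)) 0

lengthCode-code : ∀ l → lengthCode (code l) ≡ length l
lengthCode-code l = trans (FoldCode.foldCode-code (app₁ succF (arg 0)) 0 l) (counting l 0)
  where
  counting : ∀ (l : List ℕ) a → foldl (λ a _ → suc a) a l ≡ a + length l
  counting []      a = sym (+-identityʳ a)
  counting (x ∷ l) a = trans (counting l (suc a)) (sym (+-suc a (length l)))

tagAtom bodyAtom : Atom → ℕ
tagAtom (eqA _ _)  = 0
tagAtom (neqA _ _) = 1
tagAtom (relA _ _) = 2
bodyAtom (eqA u v)   = ⟪ u , v ⟫
bodyAtom (neqA u v)  = ⟪ u , v ⟫
bodyAtom (relA r vs) = ⟪ r , code vs ⟫

encAtom-split : ∀ a → encAtom a ≡ ⟪ tagAtom a , bodyAtom a ⟫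
encAtom-split (eqA _ _)  = refl
encAtom-split (neqA _ _) = refl
encAtom-split (relA _ _) = refl

encAtom-injective : ∀ {a b} → encAtom a ≡ encAtom b → a ≡ b
encAtom-injective {a} {b} e
  with pair-injective (tagAtom a) (bodyAtom a) (tagAtom b) (bodyAtom b)
         (trans (sym (encAtom-split a)) (trans e (encAtom-split b)))
encAtom-injective {eqA u v}   {eqA u' v'}   _ | _ , e
  with pair-injective u v u' v' e
... | refl , refl = refl
encAtom-injective {neqA u v}  {neqA u' v'}  _ | _ , e
  with pair-injective u v u' v' e
... | refl , refl = refl
encAtom-injective {relA r vs} {relA r' vs'} _ | _ , e
  with pair-injective r (code vs) r' (code vs') e
... | refl , e' = cong (relA r) (code-injective e')
encAtom-injective {eqA _ _}  {neqA _ _} _ | () , _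
encAtom-injective {eqA _ _}  {relA _ _} _ | () , _
encAtom-injective {neqA _ _} {eqA _ _}  _ | () , _
encAtom-injective {neqA _ _} {relA _ _} _ | () , _
encAtom-injective {relA _ _} {eqA _ _}  _ | () , _
encAtom-injective {relA _ _} {neqA _ _} _ | () , _

encDisjP-injective : ∀ {d d'} → encDisjP d ≡ encDisjP d' → d ≡ d'
encDisjP-injective {dP k as} {dP k' as'} e
  with pair-injective k (code (map encAtom as)) k' (code (map encAtom as')) e
... | refl , e' = cong (dP k) (map-injective encAtom-injective (code-injective e'))

tagQF bodyQF : QF → ℕ
tagQF (atom _)  = 0
tagQF top       = 1
tagQF (neg _)   = 2
tagQF (and _ _) = 3
tagQF (or _ _)  = 4
bodyQF (atom a)  = encAtom a
bodyQF top       = 0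
bodyQF (neg φ)   = encQF φ
bodyQF (and φ ψ) = ⟪ encQF φ , encQF ψ ⟫
bodyQF (or φ ψ)  = ⟪ encQF φ , encQF ψ ⟫

encQF-tag : ∀ φ t b → encQF φ ≡ ⟪ t , b ⟫ → tagQF φ ≡ t × bodyQF φ ≡ b
encQF-tag (atom _)  t b e = pair-injective _ _ t b e
encQF-tag top       t b e = pair-injective _ _ t b e
encQF-tag (neg _)   t b e = pair-injective _ _ t b e
encQF-tag (and _ _) t b e = pair-injective _ _ t b e
encQF-tag (or _ _)  t b e = pair-injective _ _ t b e

encQF-top-inv : ∀ φ → encQF φ ≡ encQF top → φ ≡ top
encQF-top-inv φ e with encQF-tag φ 1 0 e
encQF-top-inv top      e | _ = refl
encQF-top-inv (atom _) e | () , _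
encQF-top-inv (neg _)  e | () , _
encQF-top-inv (and _ _) e | () , _
encQF-top-inv (or _ _) e | () , _

encQF-atom-inv : ∀ φ x → encQF φ ≡ ⟪ 0 , x ⟫ → ∃[ a ] (φ ≡ atom a × encAtom a ≡ x)
encQF-atom-inv φ x e with encQF-tag φ 0 x e
encQF-atom-inv (atom a)  x e | _ , e' = a , refl , e'
encQF-atom-inv top       x e | () , _
encQF-atom-inv (neg _)   x e | () , _
encQF-atom-inv (and _ _) x e | () , _
encQF-atom-inv (or _ _)  x e | () , _

encQF-and-inv : ∀ φ a b → encQF φ ≡ ⟪ 3 , ⟪ a , b ⟫ ⟫ →
                ∃[ φa ] ∃[ φb ] (φ ≡ and φa φb × encQF φa ≡ a × encQF φb ≡ b)
encQF-and-inv φ a b e with encQF-tag φ 3 ⟪ a , b ⟫ e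
encQF-and-inv (and φa φb) a b e | _ , e' = φa , φb , refl , pair-injective _ _ a b e'
encQF-and-inv (atom _)    a b e | () , _
encQF-and-inv top         a b e | () , _
encQF-and-inv (neg _)     a b e | () , _
encQF-and-inv (or _ _)    a b e | () , _

tagProg bodyProg : Prog → ℕ
tagProg zer        = 0
tagProg succ       = 1
tagProg (proj _)   = 2
tagProg (comp _ _) = 3
tagProg (prec _ _) = 4
bodyProg zer         = 0
bodyProg succ        = 0
bodyProg (proj i)    = i
bodyProg (comp f gs) = ⟪ encProg f , encProgs gs ⟫
bodyProg (prec f g)  = ⟪ encProg f , encProg g ⟫

encProg-split : ∀ p → encProg p ≡ ⟪ tagProg p , bodyProg p ⟫
encProg-split zer        = refl
encProg-split succ       = refl
encProg-split (proj _)   = refl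
encProg-split (comp _ _) = refl
encProg-split (prec _ _) = refl

encProg-tag : ∀ p t b → encProg p ≡ ⟪ t , b ⟫ → tagProg p ≡ t × bodyProg p ≡ b
encProg-tag p t b e = pair-injective _ _ t b (trans (sym (encProg-split p)) e)

encProg-comp-inv : ∀ q a b → encProg q ≡ ⟪ 3 , ⟪ a , b ⟫ ⟫ →
                   ∃[ f ] ∃[ gs ] (q ≡ comp f gs × encProg f ≡ a × encProgs gs ≡ b)
encProg-comp-inv q a b e with encProg-tag q 3 ⟪ a , b ⟫ e
encProg-comp-inv (comp f gs) a b e | _ , e' = f , gs , refl , pair-injective _ _ a b e'
encProg-comp-inv zer         a b e | () , _
encProg-comp-inv succ        a b e | () , _
encProg-comp-inv (proj _)    a b e | () , _
encProg-comp-inv (prec _ _)  a b e | () , _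

encProgs-cons-inv : ∀ gs a b → encProgs gs ≡ suc ⟪ a , b ⟫ →
                    ∃[ g ] ∃[ gs' ] (gs ≡ g ∷ gs' × encProg g ≡ a × encProgs gs' ≡ b)
encProgs-cons-inv (g ∷ gs) a b e = g , gs , refl , pair-injective _ _ a b (suc-injective e)

mutual
  encProg-injective : ∀ {p q} → encProg p ≡ encProg q → p ≡ q
  encProg-injective {p} {q} e =
    encProg-injective-sameTag p q
      (sym (proj₁ (encProg-tag q (tagProg p) (bodyProg p) (trans (sym e) (encProg-split p))))) e

  encProg-injective-sameTag : ∀ p q → tagProg p ≡ tagProg q → encProg p ≡ encProg q → p ≡ q
  encProg-injective-sameTag zer        zer          _ _ = refl
  encProg-injective-sameTag succ       succ         _ _ = refl
  encProg-injective-sameTag (proj i)   (proj j)     _ e = cong proj (pair-injective 2 i 2 j e .proj₂)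
  encProg-injective-sameTag (comp f gs) (comp f' gs') _ e
    with pair-injective (encProg f) (encProgs gs) (encProg f') (encProgs gs')
           (pair-injective 3 _ 3 _ e .proj₂)
  ... | e₁ , e₂ = cong₂ comp (encProg-injective e₁) (encProgs-injective e₂)
  encProg-injective-sameTag (prec f g) (prec f' g') _ e
    with pair-injective (encProg f) (encProg g) (encProg f') (encProg g') (pair-injective 4 _ 4 _ e .proj₂)
  ... | e₁ , e₂ = cong₂ prec (encProg-injective e₁) (encProg-injective e₂)
  encProg-injective-sameTag zer        succ       () _
  encProg-injective-sameTag zer        (proj _)   () _
  encProg-injective-sameTag zer        (comp _ _) () _
  encProg-injective-sameTag zer        (prec _ _) () _
  encProg-injective-sameTag succ       zer        () _
  encProg-injective-sameTag succ       (proj _)   () _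
  encProg-injective-sameTag succ       (comp _ _) () _
  encProg-injective-sameTag succ       (prec _ _) () _
  encProg-injective-sameTag (proj _)   zer        () _
  encProg-injective-sameTag (proj _)   succ       () _
  encProg-injective-sameTag (proj _)   (comp _ _) () _
  encProg-injective-sameTag (proj _)   (prec _ _) () _
  encProg-injective-sameTag (comp _ _) zer        () _
  encProg-injective-sameTag (comp _ _) succ       () _
  encProg-injective-sameTag (comp _ _) (proj _)   () _
  encProg-injective-sameTag (comp _ _) (prec _ _) () _
  encProg-injective-sameTag (prec _ _) zer        () _
  encProg-injective-sameTag (prec _ _) succ       () _
  encProg-injective-sameTag (prec _ _) (proj _)   () _
  encProg-injective-sameTag (prec _ _) (comp _ _) () _

  encProgs-injective : ∀ {ps qs} → encProgs ps ≡ encProgs qs → ps ≡ qs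
  encProgs-injective {[]}     {[]}     _ = refl
  encProgs-injective {p ∷ ps} {q ∷ qs} e
    with pair-injective (encProg p) (encProgs ps) (encProg q) (encProgs qs) (suc-injective e)
  ... | e₁ , e₂ = cong₂ _∷_ (encProg-injective e₁) (encProgs-injective e₂)

-- The axiom of an enumeration operator putting ⟪ t , c ⟫ into the output
-- once ⟪ t' , c ⟫ is in the input.
opaque
  axiom : ℕ → ℕ → ℕ → ℕ
  axiom t c t' = ⟪ ⟪ t , c ⟫ , code (⟪ t' , c ⟫ ∷ []) ⟫

  axiom-def : ∀ t c t' → axiom t c t' ≡ ⟪ ⟪ t , c ⟫ , code (⟪ t' , c ⟫ ∷ []) ⟫
  axiom-def t c t' = refl

record Family : Set where
  constructor family
  field
    source target guard : PRF
open Family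

FamilyAxiom : Family → ℕ → Set
FamilyAxiom φ m =
  ∃[ k ] ∃[ c ] (fun (guard φ) (k ∷ c ∷ []) ≡ 0 × m ≡ axiom (at (source φ) k) c (at (target φ) k))

axiomF : PRF
axiomF = extF (app₂ pairF (app₂ pairF (arg 0) (arg 1))
                          (app₁ succF (app₂ pairF (app₂ pairF (arg 2) (arg 1)) (constF 0))))
  (λ xs → axiom (nth xs 0) (nth xs 1) (nth xs 2)) (λ xs → sym (axiom-def (nth xs 0) (nth xs 1) (nth xs 2)))

-- on (m ∷ y ∷ []) it computes guard k c + ∣ m - axiom (source k) c (target k) ∣ for y = ⟪ k , c ⟫
familyF : Family → PRF
familyF φ =
  app₂ addF (app₂ (guard φ) K C) (app₂ distF (arg 0) (app₃ axiomF (app₁ (source φ) K) C (app₁ (target φ) K)))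
  where
  K C : PRF
  K = app₁ unpair₁F (arg 1)
  C = app₁ unpair₂F (arg 1)

familyProg : Family → Prog
familyProg φ = prog (familyF φ)

W-familyProg : ∀ φ m → W (familyProg φ) m ⇔ FamilyAxiom φ m
W-familyProg φ m = mk⇔ fwd bwd
  where
  G : ℕ → ℕ → ℕ
  G k c = fun (guard φ) (k ∷ c ∷ [])
  fwd : W (familyProg φ) m → FamilyAxiom φ m
  fwd (y , e) =
    unpair₁ y , unpair₂ y , m+n≡0⇒m≡0 _ e′ , ∣m-n∣≡0⇒m≡n (m+n≡0⇒n≡0 (G (unpair₁ y) (unpair₂ y)) e′)
    where
    e′ : G (unpair₁ y) (unpair₂ y)
         + ∣ m - axiom (at (source φ) (unpair₁ y)) (unpair₂ y) (at (target φ) (unpair₁ y)) ∣ ≡ 0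
    e′ = trans (sym (prog-ok (familyF φ) (m ∷ y ∷ []))) e
  bwd : FamilyAxiom φ m → W (familyProg φ) m
  bwd (k , c , g , refl) = ⟪ k , c ⟫ , trans (prog-ok (familyF φ) (m ∷ ⟪ k , c ⟫ ∷ []))
    (subst₂ (λ k′ c′ → G k′ c′ + ∣ m - axiom (at (source φ) k′) c′ (at (target φ) k′) ∣ ≡ 0)
      (sym (unpair₁-pair k c)) (sym (unpair₂-pair k c)) (cong₂ _+_ g (∣n-n∣≡0 m)))

unionProg : Prog → Prog → Prog
unionProg p q = comp (prog mulF) (p ∷ q ∷ [])

W-unionProg : ∀ p q m → W (unionProg p q) m ⇔ (W p m ⊎ W q m)
W-unionProg p q m = mk⇔ fwd bwd
  where
  ev : ∀ y → eval (unionProg p q) (m ∷ y ∷ []) ≡ eval p (m ∷ y ∷ []) * eval q (m ∷ y ∷ [])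
  ev y = prog-ok mulF (eval p (m ∷ y ∷ []) ∷ eval q (m ∷ y ∷ []) ∷ [])
  fwd : W (unionProg p q) m → W p m ⊎ W q m
  fwd (y , e) with m*n≡0⇒m≡0∨n≡0 (eval p (m ∷ y ∷ [])) (trans (sym (ev y)) e)
  ... | inj₁ e′ = inj₁ (y , e′)
  ... | inj₂ e′ = inj₂ (y , e′)
  bwd : W p m ⊎ W q m → W (unionProg p q) m
  bwd (inj₁ (y , e)) = y , trans (ev y) (cong (_* eval q (m ∷ y ∷ [])) e)
  bwd (inj₂ (y , e)) = y , trans (ev y) (trans (cong (eval p (m ∷ y ∷ []) *_) e) (*-zeroʳ (eval p (m ∷ y ∷ []))))

-- The axioms for = and ≠ copy ⟪ j , c ⟫ for j ≤ 1.
eqNeqFamily : Family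
eqNeqFamily = family (arg 0) (arg 0) (app₂ monusF (arg 0) (constF 1))

-- A family of relabellings of relation indices, source k ↦ target k, allowed on tuples of
-- length n when guard k n is 0, acts on tags shifted by 2 and on codes of tuples.
shift : Family → Family
shift φ = family (app₁ succF (app₁ succF (source φ))) (app₁ succF (app₁ succF (target φ)))
                 (app₂ (guard φ) (arg 0) (app₁ lengthCodeF (arg 1)))

RuleOf : Family → ℕ → ℕ → ℕ → Set
RuleOf φ i n i' = ∃[ k ] (at (source φ) k ≡ i × at (target φ) k ≡ i' × fun (guard φ) (k ∷ n ∷ []) ≡ 0)

AnyRule : List Family → ℕ → ℕ → ℕ → Set
AnyRule fs i n i' = Any (λ φ → RuleOf φ i n i') fs

RelAxiom : List Family → ℕ → Set
RelAxiom fs m = ∃[ i ] ∃[ c ] ∃[ i' ] (AnyRule fs i (lengthCode c) i' × m ≡ axiom (2 + i) c (2 + i'))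

relabelProg : List Family → Prog
relabelProg []       = familyProg eqNeqFamily
relabelProg (φ ∷ fs) = unionProg (familyProg (shift φ)) (relabelProg fs)

W-relabelProg : ∀ fs m → W (relabelProg fs) m ⇔ (FamilyAxiom eqNeqFamily m ⊎ RelAxiom fs m)
W-relabelProg [] m = mk⇔ (λ w → inj₁ (to (W-familyProg eqNeqFamily m) w)) bwd
  where
  bwd : FamilyAxiom eqNeqFamily m ⊎ RelAxiom [] m → W (relabelProg []) m
  bwd (inj₁ a) = from (W-familyProg eqNeqFamily m) a
  bwd (inj₂ (_ , _ , _ , () , _))
W-relabelProg (φ ∷ fs) m = mk⇔ fwd bwd
  where
  union : W (relabelProg (φ ∷ fs)) m ⇔ (W (familyProg (shift φ)) m ⊎ W (relabelProg fs) m)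
  union = W-unionProg (familyProg (shift φ)) (relabelProg fs) m
  fromShifted : FamilyAxiom (shift φ) m → RelAxiom (φ ∷ fs) m
  fromShifted (k , c , g , e) = at (source φ) k , c , at (target φ) k , here (k , refl , refl , g) , e
  fromRest : FamilyAxiom eqNeqFamily m ⊎ RelAxiom fs m → FamilyAxiom eqNeqFamily m ⊎ RelAxiom (φ ∷ fs) m
  fromRest (inj₁ a)                   = inj₁ a
  fromRest (inj₂ (i , c , i' , r , e)) = inj₂ (i , c , i' , there r , e)
  fromUnion : W (familyProg (shift φ)) m ⊎ W (relabelProg fs) m →
              FamilyAxiom eqNeqFamily m ⊎ RelAxiom (φ ∷ fs) m
  fromUnion (inj₁ w) = inj₂ (fromShifted (to (W-familyProg (shift φ) m) w))
  fromUnion (inj₂ w) = fromRest (to (W-relabelProg fs m) w)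
  fwd : W (relabelProg (φ ∷ fs)) m → FamilyAxiom eqNeqFamily m ⊎ RelAxiom (φ ∷ fs) m
  fwd w = fromUnion (to union w)
  bwd : FamilyAxiom eqNeqFamily m ⊎ RelAxiom (φ ∷ fs) m → W (relabelProg (φ ∷ fs)) m
  bwd (inj₁ a) = from union (inj₂ (from (W-relabelProg fs m) (inj₁ a)))
  bwd (inj₂ (_ , c , _ , here (k , refl , refl , g) , e)) =
    from union (inj₁ (from (W-familyProg (shift φ) m) (k , c , g , e)))
  bwd (inj₂ (i , c , i' , there r , e)) = from union (inj₂ (from (W-relabelProg fs m) (inj₂ (i , c , i' , r , e))))

axiom-inv : ∀ n l t c t' → ⟪ n , code l ⟫ ≡ axiom t c t' → n ≡ ⟪ t , c ⟫ × l ≡ ⟪ t' , c ⟫ ∷ []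
axiom-inv n l t c t' e
  with pair-injective n (code l) ⟪ t , c ⟫ (code (⟪ t' , c ⟫ ∷ [])) (trans e (axiom-def t c t'))
... | e₁ , e₂ = e₁ , code-injective e₂

≡⇒⇔ : ∀ {A B : Set} → A ≡ B → A ⇔ B
≡⇒⇔ refl = mk⇔ (λ a → a) (λ a → a)

Relabels : List Family → Sig → Sig → Set
Relabels fs R R' = ∀ i l → R i l ⇔ (∃[ i' ] (AnyRule fs i (length l) i' × R' i' l))

module _ {E N : ℕ → ℕ → Set} {R R' : Sig} (fs : List Family) (H : Relabels fs R R') where

  private
    q : Prog
    q = relabelProg fs

    rule-code : ∀ {i i'} l → AnyRule fs i (lengthCode (code l)) i' ⇔ AnyRule fs i (length l) i'
    rule-code {i} {i'} l = ≡⇒⇔ (cong (λ n → AnyRule fs i n i') (lengthCode-code l))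

    complete : ∀ n → PG E N R n → Ψ q (PG E N R') n
    complete n (inj₁ (u , v , refl , e)) =
      ⟪ 0 , code (u ∷ v ∷ []) ⟫ ∷ [] , inj₁ (u , v , refl , e) ∷ [] ,
      from (W-relabelProg fs _) (inj₁ (0 , code (u ∷ v ∷ []) , refl , sym (axiom-def 0 _ 0)))
    complete n (inj₂ (inj₁ (u , v , refl , e))) =
      ⟪ 1 , code (u ∷ v ∷ []) ⟫ ∷ [] , inj₂ (inj₁ (u , v , refl , e)) ∷ [] ,
      from (W-relabelProg fs _) (inj₁ (1 , code (u ∷ v ∷ []) , refl , sym (axiom-def 1 _ 1)))
    complete n (inj₂ (inj₂ (i , l , refl , r))) with to (H i l) r
    ... | i' , rule , r' =
      ⟪ 2 + i' , code l ⟫ ∷ [] , inj₂ (inj₂ (i' , l , refl , r')) ∷ [] ,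
      from (W-relabelProg fs _) (inj₂ (i , code l , i' , from (rule-code l) rule , sym (axiom-def (2 + i) _ (2 + i'))))

    fromEqNeq : ∀ n j c → j ∸ 1 ≡ 0 → n ≡ ⟪ j , c ⟫ → PG E N R' ⟪ j , c ⟫ → PG E N R n
    fromEqNeq n j c g refl (inj₁ (u , v , e , p))         = inj₁ (u , v , e , p)
    fromEqNeq n j c g refl (inj₂ (inj₁ (u , v , e , p))) = inj₂ (inj₁ (u , v , e , p))
    fromEqNeq n j c g refl (inj₂ (inj₂ (i , l , e , _)))
      with pair-injective j c (2 + i) (code l) e
    ... | refl , _ = ⊥-elim (0≢1+n (sym g))

    fromRel : ∀ n i c i' → AnyRule fs i (lengthCode c) i' → n ≡ ⟪ 2 + i , c ⟫ →
              PG E N R' ⟪ 2 + i' , c ⟫ → PG E N R n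
    fromRel n i c i' rule refl (inj₁ (u , v , e , _))
      with () ← proj₁ (pair-injective (2 + i') c 0 (code (u ∷ v ∷ [])) e)
    fromRel n i c i' rule refl (inj₂ (inj₁ (u , v , e , _)))
      with () ← proj₁ (pair-injective (2 + i') c 1 (code (u ∷ v ∷ [])) e)
    fromRel n i c i' rule refl (inj₂ (inj₂ (i″ , l , e , r')))
      with pair-injective (2 + i') c (2 + i″) (code l) e
    ... | refl , refl =
      inj₂ (inj₂ (i , l , refl , from (H i l) (i' , to (rule-code l) rule , r')))

    sound : ∀ n l → All (PG E N R') l →
            FamilyAxiom eqNeqFamily ⟪ n , code l ⟫ ⊎ RelAxiom fs ⟪ n , code l ⟫ → PG E N R n
    sound n l all (inj₁ (j , c , g , e)) with axiom-inv n l j c j e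
    ... | en , refl with all
    ...   | b ∷ [] = fromEqNeq n j c g en b
    sound n l all (inj₂ (i , c , i' , rule , e)) with axiom-inv n l (2 + i) c (2 + i') e
    ... | en , refl with all
    ...   | b ∷ [] = fromRel n i c i' rule en b

  PG-relabel : PG E N R ≐ Ψ q (PG E N R')
  PG-relabel n = mk⇔ (complete n) (λ (l , all , w) → sound n l all (to (W-relabelProg fs _) w))

≐-sym : ∀ {A B} → A ≐ B → B ≐ A
≐-sym e n = mk⇔ (from (e n)) (to (e n))

≐-trans : ∀ {A B C} → A ≐ B → B ≐ C → A ≐ C
≐-trans e e′ n = mk⇔ (λ a → to (e′ n) (to (e n) a)) (λ c → from (e n) (from (e′ n) c))

All-mono : ∀ {A B : Pred} {l} → (∀ n → A n → B n) → All A l → All B l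
All-mono f []       = []
All-mono f (a ∷ as) = f _ a ∷ All-mono f as

Ψ-cong : ∀ p {B B′} → B ≐ B′ → Ψ p B ≐ Ψ p B′
Ψ-cong p e n = mk⇔ (λ (l , all , w) → l , All-mono (λ m → to (e m)) all , w)
                   (λ (l , all , w) → l , All-mono (λ m → from (e m)) all , w)

Relabels-map : ∀ {fs R R'} → Relabels fs R R' → ∀ f →
               Relabels fs (λ i l → R i (map f l)) (λ i l → R' i (map f l))
Relabels-map {fs} {R} {R'} H f i l =
  subst (λ n → R i (map f l) ⇔ (∃[ i' ] (AnyRule fs i n i' × R' i' (map f l)))) (length-map f l) (H i (map f l))

relabel-≤e : ∀ {R R'} fs → Relabels fs R R' → Pos R ≤e Pos R'
relabel-≤e fs H = relabelProg fs , PG-relabel fs H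

relabel-≤se : ∀ {R R'} fs → Relabels fs R R' → Enum R ≤se Enum R'
relabel-≤se fs H = relabelProg fs , λ where
  B (f , surj , e) → f , surj , ≐-trans (Ψ-cong (relabelProg fs) e) (≐-sym (PG-relabel fs (Relabels-map H f)))

interleave-even : ∀ {X : Set₁} (f g : ℕ → X) k → interleave f g (k + k) ≡ f k
interleave-even f g zero    = refl
interleave-even f g (suc k) rewrite +-suc k k = interleave-even (λ i → f (suc i)) (λ i → g (suc i)) k

interleave-odd : ∀ {X : Set₁} (f g : ℕ → X) k → interleave f g (suc (k + k)) ≡ g k
interleave-odd f g zero    = refl
interleave-odd f g (suc k) rewrite +-suc k k = interleave-odd (λ i → f (suc i)) (λ i → g (suc i)) k

interleave-even⇔ : ∀ (f g : Sig) k l → interleave f g (k + k) l ⇔ f k l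
interleave-even⇔ f g k l = ≡⇒⇔ (cong (λ S → S l) (interleave-even f g k))

interleave-odd⇔ : ∀ (f g : Sig) k l → interleave f g (suc (k + k)) l ⇔ g k l
interleave-odd⇔ f g k l = ≡⇒⇔ (cong (λ S → S l) (interleave-odd f g k))

even-or-odd : ∀ i → (∃[ k ] (i ≡ k + k)) ⊎ (∃[ k ] (i ≡ suc (k + k)))
even-or-odd zero = inj₁ (0 , refl)
even-or-odd (suc i) with even-or-odd i
... | inj₁ (k , refl) = inj₂ (k , refl)
... | inj₂ (k , refl) = inj₁ (suc k , cong suc (sym (+-suc k k)))

Complement : Language → Sig → Sig
Complement L R i l = length l ≡ arity L i × ¬ R i l

D≐Pos-Plus : ∀ {L} (𝓜 : Structure L) → D 𝓜 ≐ Pos (Plus 𝓜)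
D≐Pos-Plus {L} 𝓜 n = mk⇔ fwd bwd
  where
  even⇔ : ∀ k l → Plus 𝓜 (k + k) l ⇔ Rel 𝓜 k l
  even⇔ = interleave-even⇔ (Rel 𝓜) (Complement L (Rel 𝓜))
  odd⇔ : ∀ k l → Plus 𝓜 (suc (k + k)) l ⇔ Complement L (Rel 𝓜) k l
  odd⇔ = interleave-odd⇔ (Rel 𝓜) (Complement L (Rel 𝓜))
  tag : ∀ t i l → ⟪ t + 2 * i , code l ⟫ ≡ ⟪ t + (i + i) , code l ⟫
  tag t i l = cong (λ j → ⟪ t + j , code l ⟫) (cong (i +_) (+-identityʳ i))
  fwd : D 𝓜 n → Pos (Plus 𝓜) n
  fwd (inj₁ a)                             = inj₁ a
  fwd (inj₂ (inj₁ a))                      = inj₂ (inj₁ a)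
  fwd (inj₂ (inj₂ (inj₁ (i , l , e , r)))) =
    inj₂ (inj₂ (i + i , l , trans e (tag 2 i l) , from (even⇔ i l) r))
  fwd (inj₂ (inj₂ (inj₂ (i , l , e , r)))) =
    inj₂ (inj₂ (suc (i + i) , l , trans e (tag 3 i l) , from (odd⇔ i l) r))
  bwd : Pos (Plus 𝓜) n → D 𝓜 n
  bwd (inj₁ a)                     = inj₁ a
  bwd (inj₂ (inj₁ a))              = inj₂ (inj₁ a)
  bwd (inj₂ (inj₂ (j , l , e , r))) with even-or-odd j
  ... | inj₁ (i , refl) =
    inj₂ (inj₂ (inj₁ (i , l , trans e (sym (tag 2 i l)) , to (even⇔ i l) r)))
  ... | inj₂ (i , refl) =
    inj₂ (inj₂ (inj₂ (i , l , trans e (sym (tag 3 i l)) , to (odd⇔ i l) r)))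

doubleF : PRF
doubleF = app₂ addF (arg 0) (arg 0)

doublingFamily : Family
doublingFamily = family (arg 0) doubleF zeroF

Relabels-doubling : ∀ (f g : Sig) → Relabels (doublingFamily ∷ []) f (interleave f g)
Relabels-doubling f g i l = mk⇔
  (λ r → i + i , here (i , refl , refl , refl) , from (interleave-even⇔ f g i l) r)
  λ where (_ , here (k , refl , refl , _) , r) → to (interleave-even⇔ f g k l) r

evenFamily : Family
evenFamily = family doubleF doubleF zeroF

oddFamily : PRF → PRF → Family
oddFamily τ γ = family (app₁ succF doubleF) (app₁ succF (app₁ doubleF τ)) γ

Relabels-interleave : ∀ (f g g' : Sig) (τ γ : PRF) →
  (∀ k l → g k l ⇔ (fun γ (k ∷ length l ∷ []) ≡ 0 × g' (at τ k) l)) →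
  Relabels (evenFamily ∷ oddFamily τ γ ∷ []) (interleave f g) (interleave f g')
Relabels-interleave f g g' τ γ H i l = mk⇔ (fwd (even-or-odd i)) bwd
  where
  fwd : (∃[ k ] (i ≡ k + k)) ⊎ (∃[ k ] (i ≡ suc (k + k))) → interleave f g i l →
        ∃[ i' ] (AnyRule (evenFamily ∷ oddFamily τ γ ∷ []) i (length l) i' × interleave f g' i' l)
  fwd (inj₁ (k , refl)) r =
    k + k , here (k , refl , refl , refl) ,
    from (interleave-even⇔ f g' k l) (to (interleave-even⇔ f g k l) r)
  fwd (inj₂ (k , refl)) r with to (H k l) (to (interleave-odd⇔ f g k l) r)
  ... | γ0 , r' =
    suc (at τ k + at τ k) , there (here (k , refl , refl , γ0)) , from (interleave-odd⇔ f g' (at τ k) l) r'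
  bwd : ∃[ i' ] (AnyRule (evenFamily ∷ oddFamily τ γ ∷ []) i (length l) i' × interleave f g' i' l) →
        interleave f g i l
  bwd (_ , here (k , refl , refl , _) , r) =
    from (interleave-even⇔ f g k l) (to (interleave-even⇔ f g' k l) r)
  bwd (_ , there (here (k , refl , refl , γ0)) , r) =
    from (interleave-odd⇔ f g k l) (from (H k l) (γ0 , to (interleave-odd⇔ f g' (at τ k) l) r))

-- Type checking must never normalise the code of a concrete program or formula (a tower of
-- triangular numbers in unary), so codes are assembled from opaque constructors.
opaque
  compCode : ℕ → ℕ → ℕ
  compCode f gs = ⟪ 3 , ⟪ f , gs ⟫ ⟫

  consCode : ℕ → ℕ → ℕ
  consCode g gs = suc ⟪ g , gs ⟫

  compCode-def : ∀ f gs → compCode f gs ≡ ⟪ 3 , ⟪ f , gs ⟫ ⟫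
  compCode-def f gs = refl

  consCode-def : ∀ g gs → consCode g gs ≡ suc ⟪ g , gs ⟫
  consCode-def g gs = refl

  encProg-comp : ∀ f gs → encProg (comp f gs) ≡ compCode (encProg f) (encProgs gs)
  encProg-comp f gs = refl

  encProgs-cons : ∀ g gs → encProgs (g ∷ gs) ≡ consCode (encProg g) (encProgs gs)
  encProgs-cons g gs = refl

compCodeF consCodeF : PRF
compCodeF = extF (app₂ pairF (constF 3) pairF) (λ xs → compCode (nth xs 0) (nth xs 1))
  (λ xs → sym (compCode-def (nth xs 0) (nth xs 1)))
consCodeF = extF (app₁ succF pairF) (λ xs → consCode (nth xs 0) (nth xs 1))
  (λ xs → sym (consCode-def (nth xs 0) (nth xs 1)))

encProg-compCode-inv : ∀ q a b → encProg q ≡ compCode a b →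
                       ∃[ f ] ∃[ gs ] (q ≡ comp f gs × encProg f ≡ a × encProgs gs ≡ b)
encProg-compCode-inv q a b e = encProg-comp-inv q a b (trans e (compCode-def a b))

encProgs-consCode-inv : ∀ gs a b → encProgs gs ≡ consCode a b →
                        ∃[ g ] ∃[ gs' ] (gs ≡ g ∷ gs' × encProg g ≡ a × encProgs gs' ≡ b)
encProgs-consCode-inv gs a b e = encProgs-cons-inv gs a b (trans e (consCode-def a b))

encProg-comp₂ : ∀ f g h →
  encProg (comp f (g ∷ h ∷ [])) ≡ compCode (encProg f) (consCode (encProg g) (consCode (encProg h) 0))
encProg-comp₂ f g h = begin
  encProg (comp f (g ∷ h ∷ []))
    ≡⟨ encProg-comp f (g ∷ h ∷ []) ⟩
  compCode (encProg f) (encProgs (g ∷ h ∷ []))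
    ≡⟨ cong (compCode (encProg f)) (encProgs-cons g (h ∷ [])) ⟩
  compCode (encProg f) (consCode (encProg g) (encProgs (h ∷ [])))
    ≡⟨ cong (λ z → compCode (encProg f) (consCode (encProg g) z)) (encProgs-cons h []) ⟩
  compCode (encProg f) (consCode (encProg g) (consCode (encProg h) 0)) ∎
  where open ≡-Reasoning

encProgs-pair-inv : ∀ gs b c → encProgs gs ≡ consCode b (consCode c 0) →
                    ∃[ g ] ∃[ h ] (gs ≡ g ∷ h ∷ [] × encProg g ≡ b × encProg h ≡ c)
encProgs-pair-inv gs b c e =
  let g , gs′ , eq , eg , e′ = encProgs-consCode-inv gs b (consCode c 0) e
      h , gs″ , eq′ , eh , e″ = encProgs-consCode-inv gs′ c 0 e′
  in g , h , trans eq (cong (g ∷_) (trans eq′ (cong (h ∷_) (encProgs-injective {gs″} {[]} e″)))) , eg , eh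

encProg-comp₂-inv : ∀ q a b c → encProg q ≡ compCode a (consCode b (consCode c 0)) →
  ∃[ f ] ∃[ g ] ∃[ h ] (q ≡ comp f (g ∷ h ∷ []) × encProg f ≡ a × encProg g ≡ b × encProg h ≡ c)
encProg-comp₂-inv q a b c e =
  let f , gs , eq , ef , egs = encProg-compCode-inv q a (consCode b (consCode c 0)) e
      g , h , eq′ , eg , eh = encProgs-pair-inv gs b c egs
  in f , g , h , trans eq (cong (comp f) eq′) , ef , eg , eh

numeralCodeF : PRF
numeralCodeF = recursionF (constF (encProg zer)) (app₂ compCodeF (constF (encProg succ)) (app₂ consCodeF (arg 0) zeroF))
  (λ xs → encProg (numeral (nth xs 0))) refl (λ _ → refl)
  (λ n _ → sym (trans (encProg-comp succ (numeral n ∷ []))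
                      (cong (compCode (encProg succ)) (encProgs-cons (numeral n) []))))

opaque
  distanceTo : PRF → Prog
  distanceTo g = prog (app₂ distF (arg 0) (app₁ g (arg 1)))

  eval-distanceTo : ∀ g m k → eval (distanceTo g) (m ∷ k ∷ []) ≡ ∣ m - at g k ∣
  eval-distanceTo g m k = prog-ok (app₂ distF (arg 0) (app₁ g (arg 1))) (m ∷ k ∷ [])

singletonProg : PRF → ℕ → Prog
singletonProg g k = comp (distanceTo g) (proj 0 ∷ numeral k ∷ [])

W-singletonProg : ∀ g k m → W (singletonProg g k) m ⇔ (m ≡ at g k)
W-singletonProg g k m = mk⇔
  (λ (y , e) → ∣m-n∣≡0⇒m≡n (trans (sym (ev y)) e))
  (λ e → 0 , trans (ev 0) (m≡n⇒∣m-n∣≡0 e))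
  where
  ev : ∀ y → eval (singletonProg g k) (m ∷ y ∷ []) ≡ ∣ m - at g k ∣
  ev y = trans (eval-distanceTo g m (eval (numeral k) (m ∷ y ∷ [])))
               (cong (λ j → ∣ m - at g j ∣) (eval-numeral k (m ∷ y ∷ [])))

singletonCodeF : PRF → PRF
singletonCodeF g = extF
  (app₂ compCodeF (constF (encProg (distanceTo g)))
    (app₂ consCodeF (constF (encProg (proj 0))) (app₂ consCodeF numeralCodeF zeroF)))
  (λ xs → encProg (singletonProg g (nth xs 0)))
  (λ xs → sym (encProg-comp₂ (distanceTo g) (proj 0) (numeral (nth xs 0))))

indicesFrom : ℕ → ℕ → List ℕ
indicesFrom a zero    = []
indicesFrom a (suc m) = a ∷ indicesFrom (suc a) m

-- the code of indicesFrom (n ∸ j) j, built from its last element backwards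
indicesCode : ℕ → ℕ → ℕ
indicesCode n zero    = 0
indicesCode n (suc j) = suc ⟪ n ∸ suc j , indicesCode n j ⟫

indicesCode-correct : ∀ n j → j ≤ n → indicesCode n j ≡ code (indicesFrom (n ∸ j) j)
indicesCode-correct n zero    _ = refl
indicesCode-correct n (suc j) p = cong (λ z → suc ⟪ n ∸ suc j , z ⟫)
  (trans (indicesCode-correct n j (<⇒≤ p)) (cong (λ a → code (indicesFrom a j)) (+-∸-assoc 1 p)))

variablesCode-correct : ∀ n → indicesCode n n ≡ code (indicesFrom 0 n)
variablesCode-correct n =
  trans (indicesCode-correct n n ≤-refl) (cong (λ a → code (indicesFrom a n)) (n∸n≡0 n))

variablesCodeF : PRF
variablesCodeF = extF (app₂ indicesCodeF (arg 0) (arg 0)) (λ xs → code (indicesFrom 0 (nth xs 0)))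
  (λ xs → variablesCode-correct (nth xs 0))
  where
  indicesCodeF : PRF
  indicesCodeF = recursionF zeroF (app₁ succF (app₂ pairF (app₂ monusF (arg 2) (app₁ succF (arg 1))) (arg 0)))
    (λ xs → indicesCode (nth xs 1) (nth xs 0)) refl (λ _ → refl) (λ _ _ → refl)

lookupsM-cons : ∀ env v vs → lookupsM env (v ∷ vs) ≡ Maybe.zipWith _∷_ (lookupM env v) (lookupsM env vs)
lookupsM-cons env v vs with lookupM env v | lookupsM env vs
... | just _  | just _  = refl
... | just _  | nothing = refl
... | nothing | _       = refl

lookupsM-shift : ∀ x env a m → lookupsM (x ∷ env) (indicesFrom (suc a) m) ≡ lookupsM env (indicesFrom a m)
lookupsM-shift x env a zero    = refl
lookupsM-shift x env a (suc m) = begin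
  lookupsM (x ∷ env) (indicesFrom (suc a) (suc m))
    ≡⟨ lookupsM-cons (x ∷ env) (suc a) (indicesFrom (suc (suc a)) m) ⟩
  Maybe.zipWith _∷_ (lookupM env a) (lookupsM (x ∷ env) (indicesFrom (suc (suc a)) m))
    ≡⟨ cong (Maybe.zipWith _∷_ (lookupM env a)) (lookupsM-shift x env (suc a) m) ⟩
  Maybe.zipWith _∷_ (lookupM env a) (lookupsM env (indicesFrom (suc a) m))
    ≡⟨ lookupsM-cons env a (indicesFrom (suc a) m) ⟨
  lookupsM env (indicesFrom a (suc m)) ∎
  where open ≡-Reasoning

lookupsM-variables : ∀ l → lookupsM l (indicesFrom 0 (length l)) ≡ just l
lookupsM-variables []      = refl
lookupsM-variables (x ∷ l) =
  trans (lookupsM-cons (x ∷ l) 0 (indicesFrom 1 (length l)))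
        (cong (Maybe.zipWith _∷_ (just x)) (trans (lookupsM-shift x l 0 (length l)) (lookupsM-variables l)))

module _ (L : Language) where

  atomicDisj : ℕ → DisjP
  atomicDisj k = dP 0 (relA k (indicesFrom 0 (arity L k)) ∷ [])

  arityF : PRF
  arityF = extF (app₁ (progF (proj₁ (arityComp L))) (arg 0)) (λ xs → arity L (nth xs 0))
    (λ xs → proj₂ (arityComp L) (nth xs 0))

  opaque
    atomicCode : ℕ → ℕ
    atomicCode k = encDisjP (atomicDisj k)

    atomicCode-def : ∀ k → atomicCode k ≡ ⟪ 0 , suc ⟪ ⟪ 2 , ⟪ k , code (indicesFrom 0 (arity L k)) ⟫ ⟫ , 0 ⟫ ⟫
    atomicCode-def k = refl

    atomicCode-enc : ∀ k → atomicCode k ≡ encDisjP (atomicDisj k)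
    atomicCode-enc k = refl

  atomicDisjF : PRF
  atomicDisjF = extF
    (app₂ pairF zeroF (app₁ succF
      (app₂ pairF (app₂ pairF (constF 2) (app₂ pairF (arg 0) (app₁ variablesCodeF arityF))) zeroF)))
    (λ xs → atomicCode (nth xs 0)) (λ xs → sym (atomicCode-def (nth xs 0)))

  -- the index of the Σ^p_1 formula R_k(x_1, …, x_n)
  atomicIndexF : PRF
  atomicIndexF = singletonCodeF atomicDisjF

  sat-atomicDisj : ∀ R k l → length l ≡ arity L k → satDisjP R l (atomicDisj k) ⇔ R k l
  sat-atomicDisj R k l len = mk⇔
    (λ where (([] , _) , ((as , e , r) ∷ [])) → subst (R k) (just-injective (trans (sym e) lookups)) r)
    (λ r → ([] , refl) , ((l , lookups , r) ∷ []))
    where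
    lookups : lookupsM (l ++ []) (indicesFrom 0 (arity L k)) ≡ just l
    lookups = trans (cong₂ lookupsM (++-identityʳ l) (cong (indicesFrom 0) (sym len))) (lookupsM-variables l)

  Kp-atomic : ∀ R k l → length l ≡ arity L k → Kp R (at atomicIndexF k) l ⇔ R k l
  Kp-atomic R k l len = mk⇔ fwd bwd
    where
    fwd : Kp R (at atomicIndexF k) l → R k l
    fwd (p , ep , d , wd , sat) = to (sat-atomicDisj R k l len) (subst (satDisjP R l) d≡atomic sat)
      where
      wd′ : W (singletonProg atomicDisjF k) (encDisjP d)
      wd′ = subst (λ q → W q (encDisjP d)) (encProg-injective {p} {singletonProg atomicDisjF k} ep) wd
      d≡atomic : d ≡ atomicDisj k
      d≡atomic = encDisjP-injective (trans (to (W-singletonProg atomicDisjF k (encDisjP d)) wd′) (atomicCode-enc k))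
    bwd : R k l → Kp R (at atomicIndexF k) l
    bwd r = singletonProg atomicDisjF k , refl , atomicDisj k ,
            from (W-singletonProg atomicDisjF k _) (sym (atomicCode-enc k)) , from (sat-atomicDisj R k l len) r

opaque
  addProg unpair₁Prog unpair₂Prog : Prog
  addProg     = prog addF
  unpair₁Prog = prog (app₁ unpair₁F (arg 1))
  unpair₂Prog = prog (app₁ unpair₂F (arg 1))

  eval-addProg : ∀ a b → eval addProg (a ∷ b ∷ []) ≡ a + b
  eval-addProg a b = prog-ok addF (a ∷ b ∷ [])

  eval-unpair₁Prog : ∀ m y → eval unpair₁Prog (m ∷ y ∷ []) ≡ unpair₁ y
  eval-unpair₁Prog m y = prog-ok (app₁ unpair₁F (arg 1)) (m ∷ y ∷ [])

  eval-unpair₂Prog : ∀ m y → eval unpair₂Prog (m ∷ y ∷ []) ≡ unpair₂ y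
  eval-unpair₂Prog m y = prog-ok (app₁ unpair₂F (arg 1)) (m ∷ y ∷ [])

-- on (m ∷ ⟪ c , y ⟫ ∷ []) it computes eval p (c ∷ y ∷ []) + ∣ m - at g c ∣
imageProg : PRF → Prog → Prog
imageProg g p =
  comp addProg (comp p (unpair₁Prog ∷ unpair₂Prog ∷ []) ∷ distanceTo (app₁ g unpair₁F) ∷ [])

W-imageProg : ∀ g p m → W (imageProg g p) m ⇔ (∃[ c ] (W p c × m ≡ at g c))
W-imageProg g p m = mk⇔ fwd bwd
  where
  ev : ∀ c y → eval (imageProg g p) (m ∷ ⟪ c , y ⟫ ∷ []) ≡ eval p (c ∷ y ∷ []) + ∣ m - at g c ∣
  ev c y = begin
    eval (imageProg g p) (m ∷ ⟪ c , y ⟫ ∷ [])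
      ≡⟨ eval-addProg _ _ ⟩
    eval p (eval unpair₁Prog (m ∷ ⟪ c , y ⟫ ∷ []) ∷ eval unpair₂Prog (m ∷ ⟪ c , y ⟫ ∷ []) ∷ [])
      + eval (distanceTo (app₁ g unpair₁F)) (m ∷ ⟪ c , y ⟫ ∷ [])
      ≡⟨ cong₂ _+_
           (cong₂ (λ a b → eval p (a ∷ b ∷ [])) (eval-unpair₁Prog m ⟪ c , y ⟫) (eval-unpair₂Prog m ⟪ c , y ⟫))
                   (eval-distanceTo (app₁ g unpair₁F) m ⟪ c , y ⟫) ⟩
    eval p (unpair₁ ⟪ c , y ⟫ ∷ unpair₂ ⟪ c , y ⟫ ∷ []) + ∣ m - at g (unpair₁ ⟪ c , y ⟫) ∣
      ≡⟨ cong₂ (λ a b → eval p (a ∷ b ∷ []) + ∣ m - at g a ∣) (unpair₁-pair c y) (unpair₂-pair c y) ⟩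
    eval p (c ∷ y ∷ []) + ∣ m - at g c ∣ ∎
    where open ≡-Reasoning
  fromPair : ∀ z → ∃[ c ] ∃[ y ] (⟪ c , y ⟫ ≡ z) → eval (imageProg g p) (m ∷ z ∷ []) ≡ 0 →
             ∃[ c ] (W p c × m ≡ at g c)
  fromPair _ (c , y , refl) e =
    c , (y , m+n≡0⇒m≡0 (eval p (c ∷ y ∷ [])) e′) , ∣m-n∣≡0⇒m≡n (m+n≡0⇒n≡0 (eval p (c ∷ y ∷ [])) e′)
    where
    e′ : eval p (c ∷ y ∷ []) + ∣ m - at g c ∣ ≡ 0
    e′ = trans (sym (ev c y)) e
  fwd : W (imageProg g p) m → ∃[ c ] (W p c × m ≡ at g c)
  fwd (z , e) = fromPair z (pair-surjective z) e
  bwd : ∃[ c ] (W p c × m ≡ at g c) → W (imageProg g p) m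
  bwd (c , (y , w) , e) = ⟪ c , y ⟫ , trans (ev c y) (cong₂ _+_ w (m≡n⇒∣m-n∣≡0 e))

imageCode : PRF → ℕ → ℕ
imageCode g i =
  compCode (encProg addProg)
    (consCode (compCode i (consCode (encProg unpair₁Prog) (consCode (encProg unpair₂Prog) 0)))
      (consCode (encProg (distanceTo (app₁ g unpair₁F))) 0))

imageCodeF : PRF → PRF
imageCodeF g = extF
  (app₂ compCodeF (constF (encProg addProg))
    (app₂ consCodeF
      (app₂ compCodeF (arg 0)
        (app₂ consCodeF (constF (encProg unpair₁Prog)) (app₂ consCodeF (constF (encProg unpair₂Prog)) zeroF)))
      (app₂ consCodeF (constF (encProg (distanceTo (app₁ g unpair₁F)))) zeroF)))
  (λ xs → imageCode g (nth xs 0)) (λ _ → refl)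

encProg-imageProg : ∀ g p → encProg (imageProg g p) ≡ imageCode g (encProg p)
encProg-imageProg g p =
  trans (encProg-comp₂ addProg (comp p (unpair₁Prog ∷ unpair₂Prog ∷ [])) (distanceTo (app₁ g unpair₁F)))
        (cong (λ z → compCode (encProg addProg) (consCode z (consCode (encProg (distanceTo (app₁ g unpair₁F))) 0)))
              (encProg-comp₂ p unpair₁Prog unpair₂Prog))

imageCode-inv : ∀ g q i → encProg q ≡ imageCode g i → ∃[ p ] (q ≡ imageProg g p × encProg p ≡ i)
imageCode-inv g q i e =
  let f , h , d , eq , ef , eh , ed =
        encProg-comp₂-inv q (encProg addProg)
          (compCode i (consCode (encProg unpair₁Prog) (consCode (encProg unpair₂Prog) 0)))
          (encProg (distanceTo (app₁ g unpair₁F))) e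
      p , u₁ , u₂ , eq′ , ep , eu₁ , eu₂ =
        encProg-comp₂-inv h i (encProg unpair₁Prog) (encProg unpair₂Prog) eh
      h≡ : h ≡ comp p (unpair₁Prog ∷ unpair₂Prog ∷ [])
      h≡ = trans eq′ (cong₂ (λ u v → comp p (u ∷ v ∷ [])) (encProg-injective eu₁) (encProg-injective eu₂))
  in p , trans eq (cong₂ comp (encProg-injective ef)
                        (cong₂ _∷_ h≡ (cong (_∷ []) (encProg-injective ed)))) , ep

conjoin : QF → List Atom → QF
conjoin φ []       = φ
conjoin φ (a ∷ as) = conjoin (and φ (atom a)) as

toDisjC : DisjP → DisjC
toDisjC (dP k as) = dC k (conjoin top as)

module _ (R : Sig) (env : List ℕ) where

  sat-conjoin⁻ : ∀ φ as → satQF R env (conjoin φ as) → satQF R env φ × All (satAtom R env) as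
  sat-conjoin⁻ φ []       s = s , []
  sat-conjoin⁻ φ (a ∷ as) s =
    let (sφ , sa) , sas = sat-conjoin⁻ (and φ (atom a)) as s in sφ , sa ∷ sas

  sat-conjoin⁺ : ∀ φ as → satQF R env φ → All (satAtom R env) as → satQF R env (conjoin φ as)
  sat-conjoin⁺ φ []       s []         = s
  sat-conjoin⁺ φ (a ∷ as) s (sa ∷ sas) = sat-conjoin⁺ (and φ (atom a)) as (s , sa) sas

sat-toDisjC : ∀ R l d → satDisjC R l (toDisjC d) ⇔ satDisjP R l d
sat-toDisjC R l (dP k as) = mk⇔
  (λ (b , s) → b , proj₂ (sat-conjoin⁻ R (l ++ proj₁ b) top as s))
  (λ (b , s) → b , sat-conjoin⁺ R (l ++ proj₁ b) top as tt s)

conjoinStep : ℕ → ℕ → ℕ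
conjoinStep a x = ⟪ 3 , ⟪ a , ⟪ 0 , x ⟫ ⟫ ⟫

conjoinStepF : PRF
conjoinStepF = extF (app₂ pairF (constF 3) (app₂ pairF (arg 0) (app₂ pairF zeroF (arg 1))))
  (λ xs → conjoinStep (nth xs 0) (nth xs 1)) (λ _ → refl)

module Conjoin = FoldCode conjoinStepF (encQF top)

translateCode : ℕ → ℕ
translateCode c = ⟪ unpair₁ c , Conjoin.foldCode (unpair₂ c) ⟫

translateCodeF : PRF
translateCodeF = extF (app₂ pairF unpair₁F (app₁ Conjoin.foldCodeF unpair₂F)) (λ xs → translateCode (nth xs 0))
  (λ _ → refl)

foldl-conjoin : ∀ φ as → foldl conjoinStep (encQF φ) (map encAtom as) ≡ encQF (conjoin φ as)
foldl-conjoin φ []       = refl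
foldl-conjoin φ (a ∷ as) = foldl-conjoin (and φ (atom a)) as

foldl-conjoin-inv : ∀ xs acc ψ → encQF ψ ≡ foldl conjoinStep acc xs →
                    ∃[ φ ] ∃[ as ] (acc ≡ encQF φ × map encAtom as ≡ xs × ψ ≡ conjoin φ as)
foldl-conjoin-inv []       acc ψ e = ψ , [] , sym e , refl , refl
foldl-conjoin-inv (x ∷ xs) acc ψ e =
  let φ₁ , as , e₁ , eas , eψ = foldl-conjoin-inv xs (conjoinStep acc x) ψ e
      φ , φb , eφ₁ , eφ , eφb = encQF-and-inv φ₁ acc ⟪ 0 , x ⟫ (sym e₁)
      a , eb , ea = encQF-atom-inv φb x eφb
  in φ , a ∷ as , sym eφ , cong₂ _∷_ ea eas ,
     trans eψ (cong (λ χ → conjoin χ as) (trans eφ₁ (cong (and φ) eb)))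

translateCode-enc : ∀ d → translateCode (encDisjP d) ≡ encDisjC (toDisjC d)
translateCode-enc (dP k as) = cong₂ ⟪_,_⟫ (unpair₁-pair k xs)
  (trans (cong Conjoin.foldCode (unpair₂-pair k xs))
         (trans (Conjoin.foldCode-code (map encAtom as)) (foldl-conjoin top as)))
  where
  xs : ℕ
  xs = code (map encAtom as)

translateCode-inv : ∀ dc c → encDisjC dc ≡ translateCode c → ∃[ d ] (dc ≡ toDisjC d × encDisjP d ≡ c)
translateCode-inv (dC k′ ψ) c e =
  let k , c₂ , ec = pair-surjective c
      xs , exs = code-surjective c₂
      c≡ : ⟪ k , code xs ⟫ ≡ c
      c≡ = trans (cong (λ z → ⟪ k , z ⟫) exs) ec
      ek , eψ = pair-injective k′ (encQF ψ) (unpair₁ c) (Conjoin.foldCode (unpair₂ c)) e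
      eψ′ : encQF ψ ≡ foldl conjoinStep (encQF top) xs
      eψ′ = trans eψ (trans (cong (λ z → Conjoin.foldCode (unpair₂ z)) (sym c≡))
                    (trans (cong Conjoin.foldCode (unpair₂-pair k (code xs))) (Conjoin.foldCode-code xs)))
      φ , as , etop , eas , eψc = foldl-conjoin-inv xs (encQF top) ψ eψ′
  in dP k as ,
     cong₂ dC (trans ek (trans (cong unpair₁ (sym c≡)) (unpair₁-pair k (code xs))))
              (trans eψc (cong (λ χ → conjoin χ as) (encQF-top-inv φ (sym etop)))) ,
     trans (cong (λ z → ⟪ k , code z ⟫) eas) c≡

-- the index of the Σ^c_1 formula equivalent to the i-th Σ^p_1 formula
translationIndexF : PRF
translationIndexF = imageCodeF translateCodeF

Kc-translation : ∀ R i l → Kc R (at translationIndexF i) l ⇔ Kp R i l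
Kc-translation R i l = mk⇔ fwd bwd
  where
  fwd : Kc R (at translationIndexF i) l → Kp R i l
  fwd (q , eq , dc , w , sat) =
    let p , q≡ , ep = imageCode-inv translateCodeF q i eq
        c , wc , ec = to (W-imageProg translateCodeF p (encDisjC dc)) (subst (λ r → W r (encDisjC dc)) q≡ w)
        d , dc≡ , ed = translateCode-inv dc c ec
    in p , ep , d , subst (W p) (sym ed) wc , to (sat-toDisjC R l d) (subst (satDisjC R l) dc≡ sat)
  bwd : Kp R i l → Kc R (at translationIndexF i) l
  bwd (p , ep , d , w , sat) =
    imageProg translateCodeF p , trans (encProg-imageProg translateCodeF p) (cong (imageCode translateCodeF) ep) ,
    toDisjC d , from (W-imageProg translateCodeF p _) (encDisjP d , w , sym (translateCode-enc d)) ,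
    from (sat-toDisjC R l d) sat

≤e-resp-≐ : ∀ {A B B′} → A ≤e B → B ≐ B′ → A ≤e B′
≤e-resp-≐ (p , e) e′ = p , ≐-trans e (Ψ-cong p e′)

arityGuardF : Language → PRF
arityGuardF L = app₂ distF (arg 1) (app₁ (arityF L) (arg 0))

Complement⇔¬Kp-atomic : ∀ L R k l →
  Complement L R k l ⇔ (∣ length l - arity L k ∣ ≡ 0 × ¬ Kp R (at (atomicIndexF L) k) l)
Complement⇔¬Kp-atomic L R k l = mk⇔ fwd bwd
  where
  fwd : Complement L R k l → ∣ length l - arity L k ∣ ≡ 0 × ¬ Kp R (at (atomicIndexF L) k) l
  fwd (len , ¬r) = m≡n⇒∣m-n∣≡0 len , λ kp → ¬r (to (Kp-atomic L R k l len) kp)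
  bwd : ∣ length l - arity L k ∣ ≡ 0 × ¬ Kp R (at (atomicIndexF L) k) l → Complement L R k l
  bwd (d , ¬kp) = len , λ r → ¬kp (from (Kp-atomic L R k l len) r)
    where
    len : length l ≡ arity L k
    len = ∣m-n∣≡0⇒m≡n d

¬Kp⇔¬Kc-translation : ∀ R k l → (¬ Kp R k l) ⇔ (0 ≡ 0 × ¬ Kc R (at translationIndexF k) l)
¬Kp⇔¬Kc-translation R k l = mk⇔ fwd bwd
  where
  fwd : ¬ Kp R k l → 0 ≡ 0 × ¬ Kc R (at translationIndexF k) l
  fwd ¬kp = refl , λ kc → ¬kp (to (Kc-translation R k l) kc)
  bwd : 0 ≡ 0 × ¬ Kc R (at translationIndexF k) l → ¬ Kp R k l
  bwd (_ , ¬kc) kp = ¬kc (from (Kc-translation R k l) kp)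

mainTheorem13 : (L : Language) (𝓐 : Structure L) →
    (P 𝓐 ≤e D 𝓐 × D 𝓐 ≐ Pos (Plus 𝓐) × Pos (Plus 𝓐) ≤e Pos (PJ 𝓐) × Pos (PJ 𝓐) ≤e Pos (TJ 𝓐))
    × (Enum (Rel 𝓐) ≤se Enum (Plus 𝓐) × Enum (Plus 𝓐) ≤se Enum (PJ 𝓐) × Enum (PJ 𝓐) ≤se Enum (TJ 𝓐))
mainTheorem13 L 𝓐 =
  (≤e-resp-≐ (relabel-≤e _ rel→plus) (≐-sym (D≐Pos-Plus 𝓐)) , D≐Pos-Plus 𝓐 ,
   relabel-≤e _ plus→pj , relabel-≤e _ pj→tj) ,
  (relabel-≤se _ rel→plus , relabel-≤se _ plus→pj , relabel-≤se _ pj→tj)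
  where
  R : Sig
  R = Rel 𝓐
  rel→plus : Relabels (doublingFamily ∷ []) R (Plus 𝓐)
  rel→plus = Relabels-doubling R (Complement L R)
  plus→pj : Relabels (evenFamily ∷ oddFamily (atomicIndexF L) (arityGuardF L) ∷ []) (Plus 𝓐) (PJ 𝓐)
  plus→pj = Relabels-interleave R (Complement L R) (λ i l → ¬ Kp R i l) (atomicIndexF L) (arityGuardF L)
              (Complement⇔¬Kp-atomic L R)
  pj→tj : Relabels (evenFamily ∷ oddFamily translationIndexF zeroF ∷ []) (PJ 𝓐) (TJ 𝓐)
  pj→tj = Relabels-interleave R (λ i l → ¬ Kp R i l) (λ i l → ¬ Kc R i l) translationIndexF zeroF
            (¬Kp⇔¬Kc-translation R)
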